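{- The nanostar dendrimer graph $D_2$ is a $G_\phi$-graph, where $D_2$ is the tree on $16$ vertices consisting of a central vertex $c$ of degree $3$, three internally disjoint paths of length $3$ starting at $c$ and ending at vertices $e_1,e_2,e_3$, and two pendant leaves attached to each of $e_1,e_2,e_3$.
   Context: $\phi$ denotes Euler's totient function, $\phi^0(n)=n$ and $\phi^i(n)=\phi(\phi^{i-1}(n))$. For a set $A$ of positive integers, $A_\phi=\{\phi^k(n): n\in A,\ k\ge 0\}$, and $G_\phi(A)$ is the simple graph with vertex set $A_\phi$ in which distinct vertices $r,s$ are adjacent iff $\phi(r)=s$ or $\phi(s)=r$. A graph $H$ is a $G_\phi$-graph if $H$ is isomorphic to $G_\phi(A)$ for some set $A$ of positive integers. -}

module Defs where

open import Data.Nat using (ℕ; zero; suc; _+_; _*_; _<_)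
open import Data.Nat.GCD using (gcd)
open import Data.Nat.Properties using (_≟_)
open import Data.List using (List; []; _∷_; length; filter; map; upTo; concatMap)
open import Data.List.Membership.Propositional using (_∈_)
open import Data.Fin using (Fin; toℕ)
open import Data.Product using (Σ; ∃; _×_; _,_)
open import Data.Sum using (_⊎_)
open import Relation.Binary.PropositionalEquality using (_≡_)
open import Relation.Nullary using (¬_)

φ : ℕ → ℕ
φ n = length (filter (λ k → gcd k n ≟ 1) (map suc (upTo n)))

φ^ : ℕ → ℕ → ℕ
φ^ zero    n = n
φ^ (suc i) n = φ (φ^ i n)

SetOfPositives : Set₁
SetOfPositives = Σ (ℕ → Set) (λ A → ∀ n → A n → 0 < n)

_∈Aφ_ : ℕ → (ℕ → Set) → Set
m ∈Aφ A = ∃ λ n → ∃ λ k → A n × φ^ k n ≡ m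

Gφ-adj : ℕ → ℕ → Set
Gφ-adj r s = ¬ (r ≡ s) × (φ r ≡ s ⊎ φ s ≡ r)

-- The nanostar dendrimer D₂ on vertex set Fin 16:
-- vertex 0 = centre c; for branch b ∈ {0,1,2}, path c – (1+5b) – (2+5b) – (3+5b)=e_b,
-- and leaves (4+5b), (5+5b) attached to e_b.
D₂-edges : List (ℕ × ℕ)
D₂-edges = concatMap branch (0 ∷ 1 ∷ 2 ∷ [])
  where
  branch : ℕ → List (ℕ × ℕ)
  branch b = (0 , 1 + 5 * b) ∷ (1 + 5 * b , 2 + 5 * b) ∷ (2 + 5 * b , 3 + 5 * b)
           ∷ (3 + 5 * b , 4 + 5 * b) ∷ (3 + 5 * b , 5 + 5 * b) ∷ []

D₂-adj : Fin 16 → Fin 16 → Set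
D₂-adj i j = ((toℕ i , toℕ j) ∈ D₂-edges) ⊎ ((toℕ j , toℕ i) ∈ D₂-edges)

IsoToGφ : ∀ {n} → (Fin n → Fin n → Set) → (ℕ → Set) → Set
IsoToGφ {n} R A = Σ (Fin n → ℕ) λ f →
    (∀ i j → f i ≡ f j → i ≡ j)
  × (∀ i → f i ∈Aφ A)
  × (∀ m → m ∈Aφ A → ∃ λ i → f i ≡ m)
  × (∀ i j → (R i j → Gφ-adj (f i) (f j)) × (Gφ-adj (f i) (f j) → R i j))

IsGφGraph : ∀ {n} → (Fin n → Fin n → Set) → Set₁
IsGφGraph R = Σ SetOfPositives λ A → IsoToGφ R (Data.Product.proj₁ A)

{-# OPTIONS --safe #-}
module Submission where

open import Defs
open import Data.Nat using (ℕ; zero; suc; _<_; _<?_)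
open import Data.Nat.Properties using (_≟_)
open import Data.Fin using (Fin; toℕ; #_)
open import Data.Fin.Properties using (all?) renaming (_≟_ to _≟ᶠ_)
open import Data.Vec using ([]; _∷_; lookup)
open import Data.Product using (∃; _×_; _,_; proj₁; proj₂)
open import Data.Product.Properties using (≡-dec)
open import Data.Sum using (_⊎_; inj₁; inj₂)
open import Data.List.Membership.DecPropositional (≡-dec _≟_ _≟_) using (_∈?_)
open import Relation.Binary.PropositionalEquality using (_≡_; refl; sym; trans; cong)
open import Relation.Nullary using (¬_; Dec)
open import Relation.Nullary.Decidable using (toWitness; ¬?; _×-dec_; _⊎-dec_; _→-dec_)

-- Label the vertices of a tree injectively by positive integers so that φ maps
-- every label to the label of the parent vertex. Then A_φ is exactly the set of
-- labels, and φ-adjacency of labels is the parent relation of the tree. For D₂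
-- the centre is 16, one branch runs 8, 4, 2 with leaves 1, 3, and the two others
-- run 32, 64, 160 with leaves 187, 205 and 48, 112, 232 with leaves 233, 295.

ParentAdj : ∀ {n} → (Fin n → Fin n) → Fin n → Fin n → Set
ParentAdj parent i j = ¬ i ≡ j × (parent i ≡ j ⊎ parent j ≡ i)

ParentAdj? : ∀ {n} (parent : Fin n → Fin n) i j → Dec (ParentAdj parent i j)
ParentAdj? parent i j = ¬? (i ≟ᶠ j) ×-dec (parent i ≟ᶠ j ⊎-dec parent j ≟ᶠ i)

module φ-Labelling {n} (label : Fin n → ℕ) (parent : Fin n → Fin n)
  (label-injective : ∀ i j → label i ≡ label j → i ≡ j)
  (φ-label : ∀ i → φ (label i) ≡ label (parent i)) where

  Label : ℕ → Set
  Label m = ∃ λ i → label i ≡ m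

  φ^-label : ∀ k i → Label (φ^ k (label i))
  φ^-label zero    i = i , refl
  φ^-label (suc k) i with φ^-label k i
  ... | j , ℓj≡φ^k = parent j , trans (sym (φ-label j)) (cong φ ℓj≡φ^k)

  ∈Aφ⇔Label : ∀ m → (m ∈Aφ Label → Label m) × (Label m → m ∈Aφ Label)
  ∈Aφ⇔Label m = to , λ ℓ → m , 0 , ℓ , refl
    where
    to : m ∈Aφ Label → Label m
    to (_ , k , (i , refl) , refl) = φ^-label k i

  Gφ-adj⇔ParentAdj : ∀ i j →
    (Gφ-adj (label i) (label j) → ParentAdj parent i j) ×
    (ParentAdj parent i j → Gφ-adj (label i) (label j))
  Gφ-adj⇔ParentAdj i j = to , from
    where
    to : Gφ-adj (label i) (label j) → ParentAdj parent i j
    to (ℓi≢ℓj , inj₁ e) = (λ { refl → ℓi≢ℓj refl }) , inj₁ (label-injective _ _ (trans (sym (φ-label i)) e))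
    to (ℓi≢ℓj , inj₂ e) = (λ { refl → ℓi≢ℓj refl }) , inj₂ (label-injective _ _ (trans (sym (φ-label j)) e))
    from : ParentAdj parent i j → Gφ-adj (label i) (label j)
    from (i≢j , inj₁ e) = (λ ℓe → i≢j (label-injective _ _ ℓe)) , inj₁ (trans (φ-label i) (cong label e))
    from (i≢j , inj₂ e) = (λ ℓe → i≢j (label-injective _ _ ℓe)) , inj₂ (trans (φ-label j) (cong label e))

  isGφGraph : (∀ i → 0 < label i) →
    (R : Fin n → Fin n → Set) → (∀ i j → (R i j → ParentAdj parent i j) × (ParentAdj parent i j → R i j)) →
    IsGφGraph R
  isGφGraph label-positive R R⇔ParentAdj =
    (Label , λ { _ (i , refl) → label-positive i }) , label , label-injective ,
    (λ i → ∈Aφ⇔Label (label i) .proj₂ (i , refl)) ,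
    (λ m m∈Aφ → ∈Aφ⇔Label m .proj₁ m∈Aφ) ,
    λ i j → (λ r → Gφ-adj⇔ParentAdj i j .proj₂ (R⇔ParentAdj i j .proj₁ r)) ,
            (λ g → R⇔ParentAdj i j .proj₂ (Gφ-adj⇔ParentAdj i j .proj₁ g))

D₂-label : Fin 16 → ℕ
D₂-label = lookup (16 ∷ 8 ∷ 4 ∷ 2 ∷ 1 ∷ 3 ∷ 32 ∷ 64 ∷ 160 ∷ 187 ∷ 205 ∷ 48 ∷ 112 ∷ 232 ∷ 233 ∷ 295 ∷ [])

-- The vertex labelled 1 is its own parent, as φ 1 = 1; the clause i ≢ j of
-- ParentAdj discards this loop, just as Gφ-adj does.
D₂-parent : Fin 16 → Fin 16
D₂-parent = lookup (# 1 ∷ # 2 ∷ # 3 ∷ # 4 ∷ # 4 ∷ # 3 ∷ # 0 ∷ # 6 ∷ # 7 ∷ # 8 ∷ # 8 ∷ # 0 ∷ # 11 ∷ # 12 ∷ # 13 ∷ # 13 ∷ [])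

D₂-adj? : ∀ i j → Dec (D₂-adj i j)
D₂-adj? i j = ((toℕ i , toℕ j) ∈? D₂-edges) ⊎-dec ((toℕ j , toℕ i) ∈? D₂-edges)

D₂-label-injective : ∀ i j → D₂-label i ≡ D₂-label j → i ≡ j
D₂-label-injective = toWitness {a? = all? λ i → all? λ j → (D₂-label i ≟ D₂-label j) →-dec (i ≟ᶠ j)} _

D₂-label-positive : ∀ i → 0 < D₂-label i
D₂-label-positive = toWitness {a? = all? λ i → 0 <? D₂-label i} _

φ-D₂-label : ∀ i → φ (D₂-label i) ≡ D₂-label (D₂-parent i)
φ-D₂-label = toWitness {a? = all? λ i → φ (D₂-label i) ≟ D₂-label (D₂-parent i)} _

D₂-adj⇔ParentAdj : ∀ i j →
  (D₂-adj i j → ParentAdj D₂-parent i j) × (ParentAdj D₂-parent i j → D₂-adj i j)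
D₂-adj⇔ParentAdj = toWitness {a? = all? λ i → all? λ j →
  (D₂-adj? i j →-dec ParentAdj? D₂-parent i j) ×-dec (ParentAdj? D₂-parent i j →-dec D₂-adj? i j)} _

theorem3p4 : IsGφGraph D₂-adj
theorem3p4 = isGφGraph D₂-label-positive D₂-adj D₂-adj⇔ParentAdj
  where open φ-Labelling D₂-label D₂-parent D₂-label-injective φ-D₂-label
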